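{- Let $k$ be a positive integer and let $H_1,\dots,H_r$ be graphs on pairwise disjoint vertex sets with $\beta(H_i)=j_i$. If $j_1+\cdots+j_r\leq k-1$, then $R_{\mathrm{vm}}(k)>|H_1|+\cdots+|H_r|$.
   Context: All graphs are finite and simple; $\alpha$ is the independence number and $|H|$ the number of vertices. For a vertex $v$ of $G$, the local complementation $G*v$ is obtained from $G$ by complementing the induced subgraph on the neighborhood $N_G(v)$, all other edges unchanged. The LC orbit $[G]_{\mathrm{LC}}$ is the set of graphs obtained from $G$ by finite sequences of local complementations. For a graph $H$, $\beta(H)=\max_{H'\in[H]_{\mathrm{LC}}}\alpha(H')$. A graph $H$ is a vertex-minor of $G$ if $H$ is isomorphic to an induced subgraph of some graph in $[G]_{\mathrm{LC}}$. $E_k$ denotes the edgeless graph on $k$ vertices. The vertex-minor Ramsey number $R_{\mathrm{vm}}(k)$ is the smallest integer $n$ such that every graph on $n$ vertices contains $E_k$ as a vertex-minor. -}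

module Defs where

open import Data.Nat using (ℕ; zero; suc; _+_)
open import Data.Bool using (Bool; true; false; not; _∧_; if_then_else_)
open import Data.Bool.Properties using (∧-comm)
open import Data.Fin using (Fin; _≟_)
open import Data.Fin.Subset using (Subset; _∈_; ∣_∣)
open import Data.Product using (Σ; ∃; _×_; _,_)
open import Function.Definitions using (Injective)
open import Relation.Nullary using (does; yes; no)
open import Relation.Binary.PropositionalEquality using (_≡_; refl; sym; cong)

record Graph (n : ℕ) : Set where
  field
    adj    : Fin n → Fin n → Bool
    adj-sym : ∀ x y → adj x y ≡ adj y x
    adj-irr : ∀ x → adj x x ≡ false
open Graph public

-- Local complementation at v: complement the induced subgraph on N(v)
-- (pairs of distinct vertices x, y both adjacent to v); other edges unchanged.
lcAdj : ∀ {n} → Graph n → Fin n → Fin n → Fin n → Bool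
lcAdj G v x y =
  if adj G v x ∧ adj G v y ∧ not (does (x ≟ y)) then not (adj G x y) else adj G x y

private
  ≟-sym : ∀ {n} (x y : Fin n) → does (x ≟ y) ≡ does (y ≟ x)
  ≟-sym x y with x ≟ y | y ≟ x
  ... | yes _ | yes _ = refl
  ... | no _  | no _  = refl
  ... | yes p | no q  = Data.Empty.⊥-elim (q (sym p))
    where import Data.Empty
  ... | no p  | yes q = Data.Empty.⊥-elim (p (sym q))
    where import Data.Empty

  ≟-refl : ∀ {n} (x : Fin n) → does (x ≟ x) ≡ true
  ≟-refl x with x ≟ x
  ... | yes _ = refl
  ... | no p  = Data.Empty.⊥-elim (p refl)
    where import Data.Empty

  lc-sym : ∀ {n} (G : Graph n) v x y → lcAdj G v x y ≡ lcAdj G v y x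
  lc-sym G v x y
    rewrite ∧-comm (adj G v x) (adj G v y ∧ not (does (x ≟ y)))
          | ≟-sym x y | adj-sym G x y
          | Data.Bool.Properties.∧-assoc (adj G v y) (not (does (y ≟ x))) (adj G v x)
          | ∧-comm (not (does (y ≟ x))) (adj G v x)
          = refl
    where import Data.Bool.Properties

  lc-irr : ∀ {n} (G : Graph n) v x → lcAdj G v x x ≡ false
  lc-irr G v x rewrite ≟-refl x | adj-irr G x
    with adj G v x
  ... | true = refl
  ... | false = refl

_*_ : ∀ {n} → Graph n → Fin n → Graph n
G * v = record { adj = lcAdj G v ; adj-sym = lc-sym G v ; adj-irr = lc-irr G v }

data LCOrbit {n : ℕ} (G : Graph n) : Graph n → Set where
  here : LCOrbit G G
  step : ∀ {H} → LCOrbit G H → (v : Fin n) → LCOrbit G (H * v)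

Independent : ∀ {n} → Graph n → Subset n → Set
Independent G S = ∀ x y → x ∈ S → y ∈ S → adj G x y ≡ false

IsAlpha : ∀ {n} → Graph n → ℕ → Set
IsAlpha {n} G a =
  (Σ (Subset n) λ S → Independent G S × ∣ S ∣ ≡ a) ×
  (∀ (S : Subset n) → Independent G S → ∣ S ∣ Data.Nat.≤ a)

IsBeta : ∀ {n} → Graph n → ℕ → Set
IsBeta {n} H b =
  (Σ (Graph n) λ H' → LCOrbit H H' × IsAlpha H' b) ×
  (∀ (H' : Graph n) → LCOrbit H H' → ∀ a → IsAlpha H' a → a Data.Nat.≤ b)

VertexMinor : ∀ {m n} → Graph m → Graph n → Set
VertexMinor {m} {n} H G =
  Σ (Graph n) λ G' → LCOrbit G G' ×
    (Σ (Fin m → Fin n) λ f → Injective _≡_ _≡_ f ×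
       (∀ x y → adj H x y ≡ adj G' (f x) (f y)))

E : (k : ℕ) → Graph k
E k = record { adj = λ _ _ → false ; adj-sym = λ _ _ → refl ; adj-irr = λ _ → refl }

AllContainE : ℕ → ℕ → Set
AllContainE k n = ∀ (G : Graph n) → VertexMinor (E k) G

IsRvm : ℕ → ℕ → Set
IsRvm k n = AllContainE k n × (∀ m → m Data.Nat.< n → (AllContainE k m → Data.Empty.⊥))
  where import Data.Empty

sumF : ∀ {r} → (Fin r → ℕ) → ℕ
sumF {zero}  f = 0
sumF {suc r} f = f Fin.zero + sumF (λ i → f (Fin.suc i))
  where import Data.Fin as Fin

-- Local complementation at a vertex of one summand of a disjoint union never
-- touches the other summand, so every graph in the LC orbit of H₁ ⊕ ⋯ ⊕ Hᵣ is
-- again a disjoint union of graphs in the orbits of the Hᵢ, and its independent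
-- sets have at most β(H₁) + ⋯ + β(Hᵣ) ≤ k − 1 vertices. An E_k vertex-minor
-- would be an independent k-set in such a graph. Hence every induced subgraph
-- of this union on n ≤ |H₁| + ⋯ + |Hᵣ| vertices has no E_k vertex-minor, and
-- so R_vm(k) exceeds |H₁| + ⋯ + |Hᵣ|.
module Submission where

open import Defs
open import Data.Nat using (ℕ; _≤_; _<_; _∸_; zero; suc; _+_; z≤n; s≤s; _<?_; _≟_)
open import Data.Nat.Properties
  using (+-mono-≤; ≤-trans; ≤-pred; ≤∧≢⇒<; ≮⇒≥; 1+n≰n)
open import Data.Fin as Fin using (Fin; _↑ˡ_; _↑ʳ_; splitAt; join; inject≤)
open import Data.Fin.Properties
  using (splitAt-↑ˡ; splitAt-↑ʳ; join-splitAt; ↑ˡ-injective; ↑ʳ-injective;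
         inject≤-injective; injective⇒≤; suc-injective; all?; any?)
open import Data.Fin.Subset using (Subset; _∈_; ∣_∣; ⊥)
open import Data.Fin.Subset.Properties using (_∈?_; anySubset?; ∣p∣≤n; ∉⊥; ∣⊥∣≡0)
open import Data.Vec using (_∷_; []; _++_; here; there; tabulate)
import Data.Vec as Vec
open import Data.Vec.Properties using (lookup∘tabulate; lookup⇒[]=; []=⇒lookup)
open import Data.Bool using (Bool; true; false)
import Data.Bool.Properties as Bool
open import Data.Sum using (_⊎_; inj₁; inj₂)
open import Data.Product using (Σ; _×_; _,_)
open import Data.Empty using (⊥-elim)
open import Function.Definitions using (Injective)
open import Relation.Nullary using (Dec; yes; no; does)
open import Relation.Nullary.Decidable using (dec-true; _→-dec_; _×-dec_)
open import Relation.Binary.PropositionalEquality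

private
  variable
    m n a b : ℕ

InducedAlong : (Fin m → Fin n) → Graph m → Graph n → Set
InducedAlong e H G = ∀ x y → adj H x y ≡ adj G (e x) (e y)

induced : Graph n → (Fin m → Fin n) → Graph m
induced G e = record
  { adj = λ x y → adj G (e x) (e y)
  ; adj-sym = λ x y → adj-sym G (e x) (e y)
  ; adj-irr = λ x → adj-irr G (e x)
  }

≟-injective : (e : Fin m → Fin n) → Injective _≡_ _≡_ e →
              ∀ x y → does (x Fin.≟ y) ≡ does (e x Fin.≟ e y)
≟-injective e e-inj x y with x Fin.≟ y | e x Fin.≟ e y
... | yes _   | yes _    = refl
... | no _    | no _     = refl
... | yes x≡y | no ex≢ey = ⊥-elim (ex≢ey (cong e x≡y))
... | no x≢y  | yes ex≡ey = ⊥-elim (x≢y (e-inj ex≡ey))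

*-induced : {H : Graph m} {G : Graph n} {e : Fin m → Fin n} →
            Injective _≡_ _≡_ e → InducedAlong e H G →
            ∀ u → InducedAlong e (H * u) (G * e u)
*-induced {e = e} e-inj H⊆G u x y
  rewrite H⊆G u x | H⊆G u y | H⊆G x y | ≟-injective e e-inj x y = refl

*-nonNeighbourˡ : (G : Graph n) (v x y : Fin n) →
                  adj G v x ≡ false → adj (G * v) x y ≡ adj G x y
*-nonNeighbourˡ G v x y vx≡false rewrite vx≡false = refl

*-nonNeighbourʳ : (G : Graph n) (v x y : Fin n) →
                  adj G v y ≡ false → adj (G * v) x y ≡ adj G x y
*-nonNeighbourʳ G v x y vy≡false rewrite vy≡false with adj G v x
... | true  = refl
... | false = refl

orbit-induced : {H H' : Graph m} {G : Graph n} {e : Fin m → Fin n} →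
                Injective _≡_ _≡_ e → InducedAlong e H G → LCOrbit H H' →
                Σ (Graph n) λ G' → LCOrbit G G' × InducedAlong e H' G'
orbit-induced {G = G} e-inj H⊆G here = G , here , H⊆G
orbit-induced {e = e} e-inj H⊆G (step {H''} H→H'' u)
  with orbit-induced e-inj H⊆G H→H''
... | G' , G→G' , H''⊆G' =
  G' * e u , step G→G' (e u) , *-induced {H = H''} {G = G'} e-inj H''⊆G' u

vertexMinor-induced : {K : Graph a} {H : Graph m} {G : Graph n} {e : Fin m → Fin n} →
                      Injective _≡_ _≡_ e → InducedAlong e H G →
                      VertexMinor K H → VertexMinor K G
vertexMinor-induced {e = e} e-inj H⊆G (H' , H→H' , f , f-inj , K⊆H')
  with orbit-induced e-inj H⊆G H→H'
... | G' , G→G' , H'⊆G' =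
  G' , G→G' , (λ x → e (f x)) , (λ ef≡ef → f-inj (e-inj ef≡ef)) ,
  λ x y → trans (K⊆H' x y) (H'⊆G' (f x) (f y))

module _ (H₁ : Graph a) (H₂ : Graph b) where

  private
    adj⊎ : Fin a ⊎ Fin b → Fin a ⊎ Fin b → Bool
    adj⊎ (inj₁ x) (inj₁ y) = adj H₁ x y
    adj⊎ (inj₂ x) (inj₂ y) = adj H₂ x y
    adj⊎ (inj₁ _) (inj₂ _) = false
    adj⊎ (inj₂ _) (inj₁ _) = false

    adj⊎-sym : ∀ s t → adj⊎ s t ≡ adj⊎ t s
    adj⊎-sym (inj₁ x) (inj₁ y) = adj-sym H₁ x y
    adj⊎-sym (inj₂ x) (inj₂ y) = adj-sym H₂ x y
    adj⊎-sym (inj₁ _) (inj₂ _) = refl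
    adj⊎-sym (inj₂ _) (inj₁ _) = refl

    adj⊎-irr : ∀ s → adj⊎ s s ≡ false
    adj⊎-irr (inj₁ x) = adj-irr H₁ x
    adj⊎-irr (inj₂ x) = adj-irr H₂ x

  _⊕_ : Graph (a + b)
  _⊕_ = record
    { adj = λ i j → adj⊎ (splitAt a i) (splitAt a j)
    ; adj-sym = λ i j → adj⊎-sym (splitAt a i) (splitAt a j)
    ; adj-irr = λ i → adj⊎-irr (splitAt a i)
    }

  ⊕-inducedˡ : InducedAlong (_↑ˡ b) H₁ _⊕_
  ⊕-inducedˡ x y rewrite splitAt-↑ˡ a x b | splitAt-↑ˡ a y b = refl

  ⊕-inducedʳ : InducedAlong (a ↑ʳ_) H₂ _⊕_
  ⊕-inducedʳ x y rewrite splitAt-↑ʳ a b x | splitAt-↑ʳ a b y = refl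

  ⊕-separated : ∀ x y → adj _⊕_ (x ↑ˡ b) (a ↑ʳ y) ≡ false
  ⊕-separated x y rewrite splitAt-↑ˡ a x b | splitAt-↑ʳ a b y = refl

data Summand (a b : ℕ) : Fin (a + b) → Set where
  left  : ∀ x → Summand a b (x ↑ˡ b)
  right : ∀ y → Summand a b (a ↑ʳ y)

summand : ∀ a b (i : Fin (a + b)) → Summand a b i
summand a b i = subst (Summand a b) (join-splitAt a b i) (summand-join (splitAt a i))
  where
  summand-join : ∀ s → Summand a b (join a b s)
  summand-join (inj₁ x) = left x
  summand-join (inj₂ y) = right y

record SplitsAs (G : Graph (a + b)) (H₁ : Graph a) (H₂ : Graph b) : Set where
  field
    left-graph  : Graph a
    left-orbit  : LCOrbit H₁ left-graph
    left-part   : InducedAlong (_↑ˡ b) left-graph G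
    right-graph : Graph b
    right-orbit : LCOrbit H₂ right-graph
    right-part  : InducedAlong (a ↑ʳ_) right-graph G
    separated   : ∀ x y → adj G (x ↑ˡ b) (a ↑ʳ y) ≡ false

⊕-orbit-splits : (H₁ : Graph a) (H₂ : Graph b) {G : Graph (a + b)} →
                 LCOrbit (H₁ ⊕ H₂) G → SplitsAs G H₁ H₂
⊕-orbit-splits H₁ H₂ here = record
  { left-orbit = here ; left-part = ⊕-inducedˡ H₁ H₂
  ; right-orbit = here ; right-part = ⊕-inducedʳ H₁ H₂
  ; separated = ⊕-separated H₁ H₂
  }
⊕-orbit-splits {a} {b} H₁ H₂ (step {G} H→G v)
  with ⊕-orbit-splits H₁ H₂ H→G | summand a b v
... | s | left u = record
  { left-orbit = step left-orbit u
  ; left-part = *-induced {H = left-graph} {G = G} (↑ˡ-injective b _ _) left-part u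
  ; right-orbit = right-orbit
  ; right-part = λ x y → trans (right-part x y)
      (sym (*-nonNeighbourʳ G (u ↑ˡ b) (a ↑ʳ x) (a ↑ʳ y) (separated u y)))
  ; separated = λ x y →
      trans (*-nonNeighbourʳ G (u ↑ˡ b) (x ↑ˡ b) (a ↑ʳ y) (separated u y)) (separated x y)
  }
  where open SplitsAs s
... | s | right u = record
  { left-orbit = left-orbit
  ; left-part = λ x y → trans (left-part x y)
      (sym (*-nonNeighbourˡ G (a ↑ʳ u) (x ↑ˡ b) (y ↑ˡ b) (u∉N x)))
  ; right-orbit = step right-orbit u
  ; right-part = *-induced {H = right-graph} {G = G} (↑ʳ-injective a _ _) right-part u
  ; separated = λ x y →
      trans (*-nonNeighbourˡ G (a ↑ʳ u) (x ↑ˡ b) (a ↑ʳ y) (u∉N x)) (separated x y)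
  }
  where
  open SplitsAs s
  u∉N : ∀ x → adj G (a ↑ʳ u) (x ↑ˡ b) ≡ false
  u∉N x = trans (adj-sym G (a ↑ʳ u) (x ↑ˡ b)) (separated x u)

⨁ : ∀ r {sizes : Fin r → ℕ} → (∀ i → Graph (sizes i)) → Graph (sumF sizes)
⨁ zero    H = E 0
⨁ (suc r) H = H Fin.zero ⊕ ⨁ r (λ i → H (Fin.suc i))

∈-↑ˡ : ∀ {x : Fin a} {xs : Subset a} (ys : Subset b) → x ∈ xs → (x ↑ˡ b) ∈ (xs ++ ys)
∈-↑ˡ ys here      = here
∈-↑ˡ ys (there p) = there (∈-↑ˡ ys p)

∈-↑ʳ : ∀ {y : Fin b} (xs : Subset a) {ys : Subset b} → y ∈ ys → (a ↑ʳ y) ∈ (xs ++ ys)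
∈-↑ʳ []       p = p
∈-↑ʳ (x ∷ xs) p = there (∈-↑ʳ xs p)

∣++∣ : (xs : Subset a) (ys : Subset b) → ∣ xs ++ ys ∣ ≡ ∣ xs ∣ + ∣ ys ∣
∣++∣ []           ys = refl
∣++∣ (true ∷ xs)  ys = cong suc (∣++∣ xs ys)
∣++∣ (false ∷ xs) ys = ∣++∣ xs ys

BetaAtMost : Graph n → ℕ → Set
BetaAtMost {n} G j =
  ∀ G' → LCOrbit G G' → (S : Subset n) → Independent G' S → ∣ S ∣ ≤ j

independent? : (G : Graph n) (S : Subset n) → Dec (Independent G S)
independent? G S = all? λ x → all? λ y →
  (x ∈? S) →-dec (y ∈? S) →-dec (adj G x y Bool.≟ false)

α-exists : (G : Graph n) → Σ ℕ (IsAlpha G)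
α-exists {n} G = largest-below n (λ S _ → ∣p∣≤n S)
  where
  largest-below : ∀ t → (∀ S → Independent G S → ∣ S ∣ ≤ t) → Σ ℕ (IsAlpha G)
  largest-below zero bound =
    0 , (⊥ , (λ x _ x∈⊥ _ → ⊥-elim (∉⊥ x∈⊥)) , ∣⊥∣≡0 n) , bound
  largest-below (suc t) bound
    with anySubset? {P = λ S → Independent G S × ∣ S ∣ ≡ suc t}
                    (λ S → independent? G S ×-dec (∣ S ∣ ≟ suc t))
  ... | yes witness = suc t , witness , bound
  ... | no none     = largest-below t λ S S-ind →
          ≤-pred (≤∧≢⇒< (bound S S-ind) (λ ∣S∣≡ → none (S , S-ind , ∣S∣≡)))

isBeta⇒betaAtMost : {H : Graph n} {j : ℕ} → IsBeta H j → BetaAtMost H j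
isBeta⇒betaAtMost (_ , maximal) H' H→H' S S-ind with α-exists H'
... | α , isAlpha@(_ , α-bound) = ≤-trans (α-bound S S-ind) (maximal H' H→H' α isAlpha)

betaAtMost-mono : {G : Graph n} {i j : ℕ} → i ≤ j → BetaAtMost G i → BetaAtMost G j
betaAtMost-mono i≤j β≤i G' G→G' S S-ind = ≤-trans (β≤i G' G→G' S S-ind) i≤j

⊕-betaAtMost : {H₁ : Graph a} {H₂ : Graph b} {j₁ j₂ : ℕ} →
               BetaAtMost H₁ j₁ → BetaAtMost H₂ j₂ → BetaAtMost (H₁ ⊕ H₂) (j₁ + j₂)
⊕-betaAtMost {a} {b} {H₁} {H₂} {j₁} {j₂} β₁ β₂ G H→G S S-ind with Vec.splitAt a S
... | xs , ys , refl = subst (_≤ j₁ + j₂) (sym (∣++∣ xs ys))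
  (+-mono-≤ (β₁ left-graph left-orbit xs xs-ind) (β₂ right-graph right-orbit ys ys-ind))
  where
  open SplitsAs (⊕-orbit-splits H₁ H₂ H→G)
  xs-ind : Independent left-graph xs
  xs-ind x y x∈ y∈ = trans (left-part x y) (S-ind _ _ (∈-↑ˡ ys x∈) (∈-↑ˡ ys y∈))
  ys-ind : Independent right-graph ys
  ys-ind x y x∈ y∈ = trans (right-part x y) (S-ind _ _ (∈-↑ʳ xs x∈) (∈-↑ʳ xs y∈))

⨁-betaAtMost : ∀ r {sizes : Fin r → ℕ} (H : ∀ i → Graph (sizes i)) (j : Fin r → ℕ) →
               (∀ i → BetaAtMost (H i) (j i)) → BetaAtMost (⨁ r H) (sumF j)
⨁-betaAtMost zero    H j β _ _ [] _ = z≤n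
⨁-betaAtMost (suc r) H j β = ⊕-betaAtMost (β Fin.zero)
  (⨁-betaAtMost r (λ i → H (Fin.suc i)) (λ i → j (Fin.suc i)) (λ i → β (Fin.suc i)))

rank : {y : Fin n} (S : Subset n) → y ∈ S → Fin ∣ S ∣
rank (true ∷ S)  here      = Fin.zero
rank (true ∷ S)  (there p) = Fin.suc (rank S p)
rank (false ∷ S) (there p) = rank S p

rank-injective : {y y' : Fin n} (S : Subset n) (p : y ∈ S) (q : y' ∈ S) →
                 rank S p ≡ rank S q → y ≡ y'
rank-injective (true ∷ S)  here      here      _ = refl
rank-injective (true ∷ S)  (there p) (there q) e = cong Fin.suc (rank-injective S p q (suc-injective e))
rank-injective (false ∷ S) (there p) (there q) e = cong Fin.suc (rank-injective S p q e)

module _ (f : Fin m → Fin n) where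

  image : Subset n
  image = tabulate λ y → does (any? λ x → f x Fin.≟ y)

  ∈-image : ∀ x → f x ∈ image
  ∈-image x = lookup⇒[]= (f x) image
    (trans (lookup∘tabulate _ (f x)) (dec-true (any? λ x' → f x' Fin.≟ f x) (x , refl)))

  image-preimage : ∀ {y} → y ∈ image → Σ (Fin m) λ x → f x ≡ y
  image-preimage {y} y∈ with any? (λ x → f x Fin.≟ y)
                          | trans (sym (lookup∘tabulate _ y)) ([]=⇒lookup y∈)
  ... | yes preimage | _ = preimage
  ... | no _         | ()

  injective⇒≤∣image∣ : Injective _≡_ _≡_ f → m ≤ ∣ image ∣
  injective⇒≤∣image∣ f-inj = injective⇒≤ {f = λ x → rank image (∈-image x)}
    (λ {x} {x'} e → f-inj (rank-injective image (∈-image x) (∈-image x') e))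

E-vertexMinor⇒≤ : {G : Graph n} {j k : ℕ} → BetaAtMost G j → VertexMinor (E k) G → k ≤ j
E-vertexMinor⇒≤ β≤j (G' , G→G' , f , f-inj , E⊆G') =
  ≤-trans (injective⇒≤∣image∣ f f-inj) (β≤j G' G→G' (image f) image-independent)
  where
  image-independent : Independent G' (image f)
  image-independent y y' y∈ y'∈ with image-preimage f y∈ | image-preimage f y'∈
  ... | x , refl | x' , refl = sym (E⊆G' x x')

proposition6p2 : (k : ℕ) → 1 ≤ k → (r : ℕ) → (sizes : Fin r → ℕ)
    → (H : (i : Fin r) → Graph (sizes i)) → (j : Fin r → ℕ)
    → (∀ i → IsBeta (H i) (j i))
    → sumF j ≤ k ∸ 1
    → ∀ n → IsRvm k n → sumF sizes < n
proposition6p2 (suc k) (s≤s z≤n) r sizes H j isBeta Σj≤k n (allContainE , _)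
  with sumF sizes <? n
... | yes N<n = N<n
... | no  N≮n = ⊥-elim (1+n≰n (E-vertexMinor⇒≤ β≤k E≼union))
  where
  n≤N : n ≤ sumF sizes
  n≤N = ≮⇒≥ N≮n
  union : Graph (sumF sizes)
  union = ⨁ r H
  β≤k : BetaAtMost union k
  β≤k = betaAtMost-mono Σj≤k (⨁-betaAtMost r H j (λ i → isBeta⇒betaAtMost (isBeta i)))
  E≼union : VertexMinor (E (suc k)) union
  E≼union = vertexMinor-induced {K = E (suc k)} {H = induced union ι} {G = union} {e = ι}
              (inject≤-injective n≤N n≤N _ _) (λ _ _ → refl) (allContainE (induced union ι))
    where
    ι : Fin n → Fin (sumF sizes)
    ι x = inject≤ x n≤N
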